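{- Let $s\ge 2$ and let $G=K(n_1,\dots,n_s)$ be a complete $s$-partite graph with parts $V_1,\dots,V_s$, and suppose at least one part has at least $6$ vertices. Then there exist an optimal $3$-relaxed coloring $f$ of $G$ (using $\chi_3(G)$ colors) and a part $V_j$ with $n_j\ge 6$ such that $|f(V_j)|=1$.
   Context: $K(n_1,\dots,n_s)$ denotes the complete $s$-partite graph whose parts $V_1,\dots,V_s$ have $n_1,\dots,n_s$ vertices. A $3$-relaxed $k$-coloring is a map $f:V\to\{1,\dots,k\}$ such that every vertex $u$ has at most $3$ neighbors $v$ with $f(v)=f(u)$; $\chi_3(G)$ is the minimum such $k$. $f(S)$ is the set of colors used on $S$. -}

module Defs where

open import Data.Nat using (ℕ; _≤_; _<_)
open import Data.Fin using (Fin; _≟_)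
open import Data.Product using (Σ; _,_; proj₁; ∃; _×_)
open import Data.List using (List; concatMap; map; filter; length)
open import Data.List.Base using (allFin)
open import Relation.Nullary using (¬_)
open import Relation.Nullary.Decidable using (¬?; _×-dec_)
open import Relation.Binary.PropositionalEquality using (_≡_)

Vertex : (s : ℕ) → (Fin s → ℕ) → Set
Vertex s n = Σ (Fin s) (λ i → Fin (n i))

vertices : (s : ℕ) (n : Fin s → ℕ) → List (Vertex s n)
vertices s n = concatMap (λ i → map (λ a → (i , a)) (allFin (n i))) (allFin s)

Adj : {s : ℕ} {n : Fin s → ℕ} → Vertex s n → Vertex s n → Set
Adj u v = ¬ (proj₁ u ≡ proj₁ v)

sameColourNeighbours : {s : ℕ} {n : Fin s → ℕ} {k : ℕ} →
  (Vertex s n → Fin k) → Vertex s n → ℕ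
sameColourNeighbours {s} {n} f u =
  length (filter (λ v → ¬? (proj₁ u ≟ proj₁ v) ×-dec (f v ≟ f u)) (vertices s n))

Is3Relaxed : {s : ℕ} {n : Fin s → ℕ} {k : ℕ} → (Vertex s n → Fin k) → Set
Is3Relaxed f = ∀ u → sameColourNeighbours f u ≤ 3

IsChi3 : (s : ℕ) (n : Fin s → ℕ) → ℕ → Set
IsChi3 s n k =
  (∃ λ (f : Vertex s n → Fin k) → Is3Relaxed f) ×
  (∀ k′ → k′ < k → ¬ (∃ λ (f : Vertex s n → Fin k′) → Is3Relaxed f))

-- Let f be a 3-relaxed k-colouring and V_i a part with at least six vertices.
-- Among six sample vertices of V_i choose one whose colour c₀ is the most frequent
-- in V_i, paint all of V_i with c₀, and move every vertex outside V_i coloured c₀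
-- (a displaced vertex) to another colour.  The displaced vertices are neighbours of
-- a c₀-coloured vertex of V_i, so there are at most three of them; if there is one,
-- c₀ occurs at most three times in V_i, leaving three samples of other colours, and
-- the displaced vertices take these colours according to their rank.  A colour d
-- then receives no more displaced vertices than it loses in V_i, so no vertex that
-- keeps d gains conflicts; and by the maximality of c₀, displaced vertices in
-- different parts never receive the same colour.

module Submission where

open import Defs
open import Data.Empty using (⊥-elim)
open import Data.Fin as Fin using (Fin; inject≤)
open import Data.Fin.Properties using (inject≤-injective)
open import Data.List using (List; []; _∷_; length; filter; map; allFin)
open import Data.List.Extrema.Nat using (argmax; f[xs]≤f[argmax])
open import Data.List.Membership.Propositional using (_∈_; lose)
open import Data.List.Membership.Propositional.Properties
  using (∈-allFin; ∈-map⁺; ∈-map⁻; ∈-concatMap⁺; ∈-filter⁺)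
open import Data.List.Properties using (length-map; filter-none)
open import Data.List.Relation.Unary.All as All using (All; []; _∷_)
open import Data.List.Relation.Unary.All.Properties using (all-filter) renaming (map⁺ to All-map⁺)
open import Data.List.Relation.Unary.AllPairs using ([]; _∷_)
import Data.List.Relation.Unary.AllPairs.Properties as AllPairs
open import Data.List.Relation.Unary.Any as Any using (here; there; any?)
open import Data.List.Relation.Unary.Unique.Propositional using (Unique)
open import Data.List.Relation.Unary.Unique.Propositional.Properties
  using (map⁺; allFin⁺; filter⁺; concat⁺)
open import Data.Nat using (ℕ; suc; _+_; _≤_; _<_; z≤n; s≤s)
open import Data.Nat.Properties
open import Data.Product using (Σ; ∃; _×_; _,_; proj₁; proj₂)
open import Data.Product.Properties using (≡-dec)
open import Data.Product.Properties.WithK using (,-injectiveʳ)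
open import Data.Sum using (_⊎_; inj₁; inj₂)
open import Function using (_∘_)
open import Relation.Binary.Definitions using (DecidableEquality)
open import Relation.Binary.PropositionalEquality
  using (_≡_; _≢_; refl; sym; trans; cong; subst)
open import Relation.Nullary using (¬_; yes; no)
open import Relation.Nullary.Decidable using (_×-dec_; _⊎-dec_; ¬?)
open import Relation.Unary using (Decidable)

module _ {A : Set} where

  count : {P : A → Set} → Decidable P → List A → ℕ
  count P? xs = length (filter P? xs)

  count-mono : ∀ {P Q : A → Set} (P? : Decidable P) (Q? : Decidable Q) →
               (∀ {x} → P x → Q x) → ∀ xs → count P? xs ≤ count Q? xs
  count-mono P? Q? P⇒Q [] = z≤n
  count-mono P? Q? P⇒Q (x ∷ xs) with P? x | Q? x
  ... | yes _  | yes _  = s≤s (count-mono P? Q? P⇒Q xs)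
  ... | yes px | no ¬qx = ⊥-elim (¬qx (P⇒Q px))
  ... | no _   | yes _  = m≤n⇒m≤1+n (count-mono P? Q? P⇒Q xs)
  ... | no _   | no _   = count-mono P? Q? P⇒Q xs

  count-none : ∀ {P : A → Set} (P? : Decidable P) → (∀ x → ¬ P x) → ∀ xs → count P? xs ≡ 0
  count-none P? ¬P xs = cong length (filter-none P? (All.universal ¬P xs))

  count-pos : ∀ {P : A → Set} (P? : Decidable P) {x xs} → x ∈ xs → P x → 1 ≤ count P? xs
  count-pos P? {xs = y ∷ _} x∈ px with P? y | x∈
  ... | yes _ | _ = s≤s z≤n
  ... | no ¬py | here refl = ⊥-elim (¬py px)
  ... | no _ | there x∈xs = count-pos P? x∈xs px

  count+count∁ : ∀ {P : A → Set} (P? : Decidable P) xs →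
                 count P? xs + count (¬? ∘ P?) xs ≡ length xs
  count+count∁ P? [] = refl
  count+count∁ P? (x ∷ xs) with P? x
  ... | yes _ = cong suc (count+count∁ P? xs)
  ... | no _ = trans (+-suc (count P? xs) _) (cong suc (count+count∁ P? xs))

  count-⊎ : ∀ {Q R : A → Set} (Q? : Decidable Q) (R? : Decidable R) xs →
            count (λ x → Q? x ⊎-dec R? x) xs ≤ count Q? xs + count R? xs
  count-⊎ Q? R? [] = z≤n
  count-⊎ Q? R? (x ∷ xs) with Q? x | R? x
  ... | yes _ | yes _ = s≤s (≤-trans (count-⊎ Q? R? xs) (+-monoʳ-≤ (count Q? xs) (n≤1+n _)))
  ... | yes _ | no _ = s≤s (count-⊎ Q? R? xs)
  ... | no _ | yes _ =
    ≤-trans (s≤s (count-⊎ Q? R? xs)) (≤-reflexive (sym (+-suc (count Q? xs) _)))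
  ... | no _ | no _ = count-⊎ Q? R? xs

  count-cover : ∀ {P Q R : A → Set} (P? : Decidable P) (Q? : Decidable Q) (R? : Decidable R) →
                (∀ {x} → P x → Q x ⊎ R x) → ∀ xs → count P? xs ≤ count Q? xs + count R? xs
  count-cover P? Q? R? cover xs =
    ≤-trans (count-mono P? (λ x → Q? x ⊎-dec R? x) cover xs) (count-⊎ Q? R? xs)

  count-disjoint : ∀ {P Q R : A → Set} (P? : Decidable P) (Q? : Decidable Q) (R? : Decidable R) →
                   (∀ {x} → Q x → P x) → (∀ {x} → R x → P x) → (∀ {x} → Q x → ¬ R x) →
                   ∀ xs → count Q? xs + count R? xs ≤ count P? xs
  count-disjoint P? Q? R? Q⇒P R⇒P Q⇒¬R [] = z≤n
  count-disjoint P? Q? R? Q⇒P R⇒P Q⇒¬R (x ∷ xs) with Q? x | R? x | P? x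
  ... | yes qx | yes rx | _ = ⊥-elim (Q⇒¬R qx rx)
  ... | yes qx | no _ | no ¬px = ⊥-elim (¬px (Q⇒P qx))
  ... | no _ | yes rx | no ¬px = ⊥-elim (¬px (R⇒P rx))
  ... | yes _ | no _ | yes _ = s≤s ih
    where ih = count-disjoint P? Q? R? Q⇒P R⇒P Q⇒¬R xs
  ... | no _ | yes _ | yes _ = ≤-trans (≤-reflexive (+-suc (count Q? xs) _)) (s≤s ih)
    where ih = count-disjoint P? Q? R? Q⇒P R⇒P Q⇒¬R xs
  ... | no _ | no _ | yes _ = m≤n⇒m≤1+n (count-disjoint P? Q? R? Q⇒P R⇒P Q⇒¬R xs)
  ... | no _ | no _ | no _ = count-disjoint P? Q? R? Q⇒P R⇒P Q⇒¬R xs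

  length≤count : ∀ {P : A → Set} (P? : Decidable P) (_≟_ : DecidableEquality A) {ys} xs →
                 Unique ys → All (_∈ xs) ys → All P ys → length ys ≤ count P? xs
  length≤count P? _≟_ xs [] [] [] = z≤n
  length≤count P? _≟_ {y ∷ ys} xs (y∉ys ∷ ys!) (y∈xs ∷ ys⊆xs) (py ∷ pys) =
    ≤-trans (+-mono-≤ (count-pos ≡y? y∈xs (py , refl)) rest)
            (count-disjoint P? ≡y? ≢y? proj₁ proj₁ (λ (_ , x≡y) (_ , x≢y) → x≢y x≡y) xs)
    where
    ≡y? = λ x → P? x ×-dec (x ≟ y)
    ≢y? = λ x → P? x ×-dec ¬? (x ≟ y)
    rest : length ys ≤ count ≢y? xs
    rest = length≤count ≢y? _≟_ xs ys! ys⊆xs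
             (All.zipWith (λ (pz , y≢z) → pz , y≢z ∘ sym) (pys , y∉ys))

  map-unique : ∀ {B : Set} {P : B → Set} (g : B → A) {xs} →
               (∀ {x y} → P x → P y → g x ≡ g y → x ≡ y) →
               All P xs → Unique xs → Unique (map g xs)
  map-unique g inj [] [] = []
  map-unique g inj (px ∷ pxs) (x∉xs ∷ xs!) =
    All-map⁺ (All.zipWith (λ (py , x≢y) gx≡gy → x≢y (inj px py gx≡gy)) (pxs , x∉xs))
      ∷ map-unique g inj pxs xs!

  take3 : ∀ {P : A → Set} {xs} → Unique xs → All P xs → 3 ≤ length xs →
          Σ A λ a → Σ A λ b → Σ A λ c → Unique (a ∷ b ∷ c ∷ []) × All P (a ∷ b ∷ c ∷ [])
  take3 {xs = a ∷ b ∷ c ∷ _} ((a≢b ∷ a≢c ∷ _) ∷ (b≢c ∷ _) ∷ _) (pa ∷ pb ∷ pc ∷ _) _ =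
    a , b , c , (a≢b ∷ a≢c ∷ []) ∷ (b≢c ∷ []) ∷ [] ∷ [] , pa ∷ pb ∷ pc ∷ []
  take3 {xs = []} _ _ ()
  take3 {xs = _ ∷ []} _ _ (s≤s ())
  take3 {xs = _ ∷ _ ∷ []} _ _ (s≤s (s≤s ()))

module _ {A : Set} (_≟_ : DecidableEquality A) where

  indexOf : A → List A → ℕ
  indexOf x [] = 0
  indexOf x (y ∷ ys) with x ≟ y
  ... | yes _ = 0
  ... | no _ = suc (indexOf x ys)

  indexOf-< : ∀ {x xs} → x ∈ xs → indexOf x xs < length xs
  indexOf-< {x} {y ∷ ys} x∈ with x ≟ y
  ... | yes _ = s≤s z≤n
  ... | no x≢y = s≤s (indexOf-< (Any.tail x≢y x∈))

  indexOf-injective : ∀ {x y zs} → x ∈ zs → y ∈ zs → indexOf x zs ≡ indexOf y zs → x ≡ y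
  indexOf-injective {x} {y} {z ∷ zs} x∈ y∈ eq with x ≟ z | y ≟ z
  ... | yes refl | yes refl = refl
  ... | yes _ | no _ = ⊥-elim (0≢1+n eq)
  ... | no _ | yes _ = ⊥-elim (0≢1+n (sym eq))
  ... | no x≢z | no y≢z =
    indexOf-injective (Any.tail x≢z x∈) (Any.tail y≢z y∈) (suc-injective eq)

module _ {s : ℕ} {n : Fin s → ℕ} where

  _≟ᵥ_ : DecidableEquality (Vertex s n)
  _≟ᵥ_ = ≡-dec Fin._≟_ Fin._≟_

  part : Fin s → List (Vertex s n)
  part i = map (i ,_) (allFin (n i))

  ∈-part⇒≡ : ∀ {i v} → v ∈ part i → proj₁ v ≡ i
  ∈-part⇒≡ v∈ with ∈-map⁻ _ v∈
  ... | _ , _ , refl = refl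

  ∈-vertices : ∀ v → v ∈ vertices s n
  ∈-vertices (i , a) =
    ∈-concatMap⁺ part (Any.map (λ { refl → ∈-map⁺ _ (∈-allFin a) }) (∈-allFin i))

  vertices-unique : Unique (vertices s n)
  vertices-unique = concat⁺
    (All-map⁺ (All.universal (λ i → map⁺ ,-injectiveʳ (allFin⁺ (n i))) (allFin s)))
    (AllPairs.map⁺ (AllPairs.tabulate⁺ λ i≢j (v∈i , v∈j) →
      i≢j (trans (sym (∈-part⇒≡ v∈i)) (∈-part⇒≡ v∈j))))

module Recolouring {s : ℕ} {n : Fin s → ℕ} {k : ℕ}
                   (f : Vertex s n → Fin k) (f-relaxed : Is3Relaxed f) (i : Fin s) where

  private
    V = vertices s n

  SameColourNeighbour? : (g : Vertex s n → Fin k) (u : Vertex s n) →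
                         Decidable (λ v → Adj u v × g v ≡ g u)
  SameColourNeighbour? g u v = ¬? (proj₁ u Fin.≟ proj₁ v) ×-dec (g v Fin.≟ g u)

  InPart : Fin k → Vertex s n → Set
  InPart d v = proj₁ v ≡ i × f v ≡ d

  InPart? : ∀ d → Decidable (InPart d)
  InPart? d v = (proj₁ v Fin.≟ i) ×-dec (f v Fin.≟ d)

  inPartCount : Fin k → ℕ
  inPartCount d = count (InPart? d) V

  ColouredOutside : Fin k → Vertex s n → Set
  ColouredOutside d v = ¬ proj₁ v ≡ i × f v ≡ d

  ColouredOutside? : ∀ d → Decidable (ColouredOutside d)
  ColouredOutside? d v = ¬? (proj₁ v Fin.≟ i) ×-dec (f v Fin.≟ d)

  Clash : Vertex s n → Vertex s n → Set
  Clash u v = Adj u v × ColouredOutside (f u) v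

  Clash? : ∀ u → Decidable (Clash u)
  Clash? u v = ¬? (proj₁ u Fin.≟ proj₁ v) ×-dec ColouredOutside? (f u) v

  inPart+clash≤3 : ∀ u → ¬ proj₁ u ≡ i → inPartCount (f u) + count (Clash? u) V ≤ 3
  inPart+clash≤3 u u∉ = ≤-trans
    (count-disjoint (SameColourNeighbour? f u) (InPart? (f u)) (Clash? u)
      (λ (v∈ , fv≡fu) → (λ u≡v → u∉ (trans u≡v v∈)) , fv≡fu)
      (λ (u≁v , _ , fv≡fu) → u≁v , fv≡fu)
      (λ (v∈ , _) (_ , v∉ , _) → v∉ v∈)
      V)
    (f-relaxed u)

  colouredOutside≤3 : ∀ a → count (ColouredOutside? (f (i , a))) V ≤ 3
  colouredOutside≤3 a = ≤-trans
    (count-mono (ColouredOutside? (f (i , a))) (SameColourNeighbour? f (i , a))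
      (λ (v∉ , fv≡) → (λ i≡v → v∉ (sym i≡v)) , fv≡) V)
    (f-relaxed (i , a))

  module _ (c₀ : Fin k) where

    Displaced : Vertex s n → Set
    Displaced = ColouredOutside c₀

    Displaced? : Decidable Displaced
    Displaced? = ColouredOutside? c₀

    record Relocation : Set where
      field
        τ : Vertex s n → Fin k
        avoids : ∀ {v} → Displaced v → τ v ≢ c₀
        fits : ∀ d → count (λ v → Displaced? v ×-dec (τ v Fin.≟ d)) V ≤ inPartCount d
        usedInPart : ∀ {v} → Displaced v → ∃ λ a → f (i , a) ≡ τ v
        separates : ∀ {u v} → Displaced u → Displaced v → τ u ≡ τ v → proj₁ u ≡ proj₁ v

    module _ (ρ : Relocation) where
      open Relocation ρ

      recoloured : Vertex s n → Fin k
      recoloured v with proj₁ v Fin.≟ i | f v Fin.≟ c₀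
      ... | yes _ | _     = c₀
      ... | no _  | yes _ = τ v
      ... | no _  | no _  = f v

      data Region (v : Vertex s n) (c : Fin k) : Set where
        inside    : proj₁ v ≡ i → c ≡ c₀ → Region v c
        displaced : Displaced v → c ≡ τ v → Region v c
        kept      : ¬ proj₁ v ≡ i → f v ≢ c₀ → c ≡ f v → Region v c

      region : ∀ v → Region v (recoloured v)
      region v with proj₁ v Fin.≟ i | f v Fin.≟ c₀
      ... | yes v∈ | _      = inside v∈ refl
      ... | no v∉  | yes fv = displaced (v∉ , fv) refl
      ... | no v∉  | no fv  = kept v∉ fv refl

      outside≢c₀ : ∀ {v} → ¬ proj₁ v ≡ i → recoloured v ≢ c₀
      outside≢c₀ {v} v∉ with region v
      ... | inside v∈ _ = ⊥-elim (v∉ v∈)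
      ... | displaced Dv eq = avoids Dv ∘ trans (sym eq)
      ... | kept _ fv≢c₀ eq = fv≢c₀ ∘ trans (sym eq)

      recoloured-inside : ∀ a → recoloured (i , a) ≡ c₀
      recoloured-inside a with region (i , a)
      ... | inside _ eq = eq
      ... | displaced (i≢i , _) _ = ⊥-elim (i≢i refl)
      ... | kept i≢i _ _ = ⊥-elim (i≢i refl)

      τ-colouredOutside≤3 : ∀ {v} → Displaced v → count (ColouredOutside? (τ v)) V ≤ 3
      τ-colouredOutside≤3 Dv with usedInPart Dv
      ... | a , fa≡τv =
        subst (λ d → count (ColouredOutside? d) V ≤ 3) fa≡τv (colouredOutside≤3 a)

      recoloured-relaxed : Is3Relaxed recoloured
      recoloured-relaxed u with region u
      ... | inside u∈ eq =
        ≤-trans (≤-reflexive (count-none (SameColourNeighbour? recoloured u) lonely V)) z≤n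
        where
        lonely : ∀ v → ¬ (Adj u v × recoloured v ≡ recoloured u)
        lonely v (u≁v , same) = outside≢c₀ (λ v∈ → u≁v (trans u∈ (sym v∈))) (trans same eq)
      ... | displaced Du eq = ≤-trans
        (count-mono (SameColourNeighbour? recoloured u) (ColouredOutside? (τ u)) same-as-τu V)
        (τ-colouredOutside≤3 Du)
        where
        same-as-τu : ∀ {v} → Adj u v × recoloured v ≡ recoloured u → ColouredOutside (τ u) v
        same-as-τu {v} (u≁v , same) with region v
        ... | inside _ eq′ = ⊥-elim (avoids Du (trans (sym eq) (trans (sym same) eq′)))
        ... | displaced Dv eq′ =
          ⊥-elim (u≁v (separates Du Dv (trans (sym eq) (trans (sym same) eq′))))
        ... | kept v∉ _ eq′ = v∉ , trans (sym eq′) (trans same eq)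
      ... | kept u∉ fu≢c₀ eq = ≤-trans
        (count-cover (SameColourNeighbour? recoloured u)
          (λ v → Displaced? v ×-dec (τ v Fin.≟ f u)) (Clash? u) classify V)
        (≤-trans (+-monoˡ-≤ (count (Clash? u) V) (fits (f u))) (inPart+clash≤3 u u∉))
        where
        classify : ∀ {v} → Adj u v × recoloured v ≡ recoloured u →
                   (Displaced v × τ v ≡ f u) ⊎ Clash u v
        classify {v} (u≁v , same) with region v
        ... | inside _ eq′ = ⊥-elim (fu≢c₀ (trans (sym eq) (trans (sym same) eq′)))
        ... | displaced Dv eq′ = inj₁ (Dv , trans (sym eq′) (trans same eq))
        ... | kept v∉ _ eq′ = inj₂ (u≁v , v∉ , trans (sym eq′) (trans same eq))

    vacuousRelocation : (∀ v → ¬ Displaced v) → Relocation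
    vacuousRelocation nothingDisplaced = record
      { τ = f
      ; avoids = λ {v} Dv → ⊥-elim (nothingDisplaced v Dv)
      ; fits = λ _ →
          ≤-trans (≤-reflexive (count-none _ (λ v → nothingDisplaced v ∘ proj₁) V)) z≤n
      ; usedInPart = λ {v} Dv → ⊥-elim (nothingDisplaced v Dv)
      ; separates = λ {u} Du → ⊥-elim (nothingDisplaced u Du)
      }

  module Samples (6≤nᵢ : 6 ≤ n i) where

    sample : Fin 6 → Vertex s n
    sample t = i , inject≤ t 6≤nᵢ

    sample-injective : ∀ {t t′} → sample t ≡ sample t′ → t ≡ t′
    sample-injective = inject≤-injective _ _ _ _ ∘ ,-injectiveʳ

    colour : Fin 6 → Fin k
    colour = f ∘ sample

    samples≤inPartCount : ∀ {d ts} → Unique ts → All (λ t → colour t ≡ d) ts →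
                          length ts ≤ inPartCount d
    samples≤inPartCount {d} {ts} ts! coloured = subst (_≤ inPartCount d) (length-map sample ts)
      (length≤count (InPart? d) _≟ᵥ_ V (map⁺ sample-injective ts!)
        (All-map⁺ (All.universal (λ _ → ∈-vertices _) ts))
        (All-map⁺ (All.map (refl ,_) coloured)))

    -- Kept abstract: unfolding the argmax makes the type checker evaluate colour
    -- counts over all vertices, which exhausts memory.
    abstract
      t₀ : Fin 6
      t₀ = argmax (inPartCount ∘ colour) Fin.zero (allFin 6)

      c₀-maximal : ∀ t → inPartCount (colour t) ≤ inPartCount (colour t₀)
      c₀-maximal t =
        All.lookup (f[xs]≤f[argmax] {f = inPartCount ∘ colour} Fin.zero (allFin 6)) (∈-allFin t)

    c₀ : Fin k
    c₀ = colour t₀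

    displaced≤3 : count (Displaced? c₀) V ≤ 3
    displaced≤3 = colouredOutside≤3 (inject≤ t₀ 6≤nᵢ)

    record Palette : Set where
      field
        first second third : Fin 6
        distinct : Unique (first ∷ second ∷ third ∷ [])
        spare : All (λ t → colour t ≢ c₀) (first ∷ second ∷ third ∷ [])
        first∼second⇒frequent : colour first ≡ colour second → 3 ≤ inPartCount (colour first)

    module _ {w : Vertex s n} (Dw : Displaced c₀ w) where

      c₀≤3 : inPartCount c₀ ≤ 3
      c₀≤3 = subst (λ d → inPartCount d ≤ 3) (proj₂ Dw)
               (m+n≤o⇒m≤o _ (inPart+clash≤3 w (proj₁ Dw)))

      Spare? : Decidable (λ t → colour t ≢ c₀)
      Spare? t = ¬? (colour t Fin.≟ c₀)

      spare≥3 : 3 ≤ count Spare? (allFin 6)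
      spare≥3 = +-cancelˡ-≤ 3 3 _ (begin
        6                                               ≡⟨ sym (count+count∁ c₀? (allFin 6)) ⟩
        count c₀? (allFin 6) + count Spare? (allFin 6)  ≤⟨ +-monoˡ-≤ _ c₀-samples≤3 ⟩
        3 + count Spare? (allFin 6)                     ∎)
        where
        open ≤-Reasoning
        c₀? = λ t → colour t Fin.≟ c₀
        c₀-samples≤3 : count c₀? (allFin 6) ≤ 3
        c₀-samples≤3 = ≤-trans
          (samples≤inPartCount (filter⁺ c₀? (allFin⁺ 6)) (all-filter c₀? (allFin 6))) c₀≤3

      -- If the first two spare samples share a colour, the third one is moved to the
      -- second place; if it shares that colour too, three samples do.
      palette : Palette
      palette with take3 (filter⁺ Spare? (allFin⁺ 6)) (all-filter Spare? (allFin 6)) spare≥3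
      ... | a , b , c , abc!@((a≢b ∷ a≢c ∷ []) ∷ (b≢c ∷ []) ∷ [] ∷ []) , (a′ ∷ b′ ∷ c′ ∷ [])
        with colour a Fin.≟ colour b
      ...   | no a≁b = record
        { first = a ; second = b ; third = c ; distinct = abc! ; spare = a′ ∷ b′ ∷ c′ ∷ []
        ; first∼second⇒frequent = ⊥-elim ∘ a≁b }
      ...   | yes a∼b = record
        { first = a ; second = c ; third = b
        ; distinct = (a≢c ∷ a≢b ∷ []) ∷ ((b≢c ∘ sym) ∷ []) ∷ [] ∷ []
        ; spare = a′ ∷ c′ ∷ b′ ∷ []
        ; first∼second⇒frequent = λ a∼c →
            samples≤inPartCount abc! (refl ∷ sym a∼b ∷ sym a∼c ∷ []) }

    module _ (pal : Palette) where
      open Palette pal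

      pick : ℕ → Fin 6
      pick 0 = first
      pick 1 = second
      pick (suc (suc _)) = third

      pick-spare : ∀ m → colour (pick m) ≢ c₀
      pick-spare 0 with spare
      ... | p ∷ _ = p
      pick-spare 1 with spare
      ... | _ ∷ p ∷ _ = p
      pick-spare (suc (suc _)) with spare
      ... | _ ∷ _ ∷ p ∷ _ = p

      pick-injective : ∀ {m m′} → m ≤ 2 → m′ ≤ 2 → pick m ≡ pick m′ → m ≡ m′
      pick-injective with distinct
      ... | (1≢2 ∷ 1≢3 ∷ []) ∷ (2≢3 ∷ []) ∷ [] ∷ [] = go
        where
        go : ∀ {m m′} → m ≤ 2 → m′ ≤ 2 → pick m ≡ pick m′ → m ≡ m′
        go z≤n z≤n _ = refl
        go z≤n (s≤s z≤n) eq = ⊥-elim (1≢2 eq)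
        go z≤n (s≤s (s≤s z≤n)) eq = ⊥-elim (1≢3 eq)
        go (s≤s z≤n) z≤n eq = ⊥-elim (1≢2 (sym eq))
        go (s≤s z≤n) (s≤s z≤n) _ = refl
        go (s≤s z≤n) (s≤s (s≤s z≤n)) eq = ⊥-elim (2≢3 eq)
        go (s≤s (s≤s z≤n)) z≤n eq = ⊥-elim (1≢3 (sym eq))
        go (s≤s (s≤s z≤n)) (s≤s z≤n) eq = ⊥-elim (2≢3 (sym eq))
        go (s≤s (s≤s z≤n)) (s≤s (s≤s z≤n)) _ = refl

      coincide : ∀ {m m′} → m ≤ 1 → m′ ≤ 1 → m ≢ m′ →
                 colour (pick m) ≡ colour (pick m′) → colour first ≡ colour second
      coincide z≤n z≤n 0≢0 _ = ⊥-elim (0≢0 refl)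
      coincide z≤n (s≤s z≤n) _ eq = eq
      coincide (s≤s z≤n) z≤n _ eq = sym eq
      coincide (s≤s z≤n) (s≤s z≤n) 1≢1 _ = ⊥-elim (1≢1 refl)

      ∈-displaced : ∀ {v} → Displaced c₀ v → v ∈ filter (Displaced? c₀) V
      ∈-displaced {v} Dv = ∈-filter⁺ (Displaced? c₀) (∈-vertices v) Dv

      rank : Vertex s n → ℕ
      rank v = indexOf _≟ᵥ_ v (filter (Displaced? c₀) V)

      rank< : ∀ {v} → Displaced c₀ v → rank v < count (Displaced? c₀) V
      rank< Dv = indexOf-< _≟ᵥ_ (∈-displaced Dv)

      rank≤2 : ∀ {v} → Displaced c₀ v → rank v ≤ 2
      rank≤2 Dv = ≤-pred (≤-trans (rank< Dv) displaced≤3)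

      rank-injective : ∀ {u v} → Displaced c₀ u → Displaced c₀ v → rank u ≡ rank v → u ≡ v
      rank-injective Du Dv = indexOf-injective _≟ᵥ_ (∈-displaced Du) (∈-displaced Dv)

      τ : Vertex s n → Fin k
      τ = colour ∘ pick ∘ rank

      fits : ∀ d → count (λ v → Displaced? c₀ v ×-dec (τ v Fin.≟ d)) V ≤ inPartCount d
      fits d = subst (_≤ inPartCount d) (length-map slot (filter P? V))
        (length≤count (InPart? d) _≟ᵥ_ V
          (map-unique slot slot-injective (all-filter P? V) (filter⁺ P? vertices-unique))
          (All.universal (λ _ → ∈-vertices _) _)
          (All-map⁺ (All.map ((refl ,_) ∘ proj₂) (all-filter P? V))))
        where
        P? = λ v → Displaced? c₀ v ×-dec (τ v Fin.≟ d)
        slot = sample ∘ pick ∘ rank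
        slot-injective : ∀ {u v} → Displaced c₀ u × τ u ≡ d → Displaced c₀ v × τ v ≡ d →
                         slot u ≡ slot v → u ≡ v
        slot-injective (Du , _) (Dv , _) =
          rank-injective Du Dv ∘ pick-injective (rank≤2 Du) (rank≤2 Dv) ∘ sample-injective

      clash-across : ∀ {u v} → Displaced c₀ u → Displaced c₀ v → Adj u v → Clash u v
      clash-across (_ , fu≡c₀) (v∉ , fv≡c₀) u≁v = u≁v , v∉ , trans fv≡c₀ (sym fu≡c₀)

      c₀≤2 : ∀ {u v} → Displaced c₀ u → Displaced c₀ v → Adj u v → inPartCount c₀ ≤ 2
      c₀≤2 {u} {v} Du Dv u≁v = subst (λ d → inPartCount d ≤ 2) (proj₂ Du)
        (≤-trans (m+n≤o⇒m≤o∸n _ (inPart+clash≤3 u (proj₁ Du)))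
                 (∸-monoʳ-≤ 3 (count-pos (Clash? u) (∈-vertices v) (clash-across Du Dv u≁v))))

      clash≤1 : ∀ {u} → Displaced c₀ u → 2 ≤ inPartCount c₀ → count (Clash? u) V ≤ 1
      clash≤1 {u} Du 2≤c₀ = ≤-trans
        (m+n≤o⇒m≤o∸n _ (subst (_≤ 3) (+-comm (inPartCount (f u)) _) (inPart+clash≤3 u (proj₁ Du))))
        (∸-monoʳ-≤ 3 (subst (λ d → 2 ≤ inPartCount d) (sym (proj₂ Du)) 2≤c₀))

      displaced≤2 : ∀ {u v} → Displaced c₀ u → Displaced c₀ v → Adj u v →
                    2 ≤ inPartCount c₀ → count (Displaced? c₀) V ≤ 2
      displaced≤2 {u} {v} Du Dv u≁v 2≤c₀ = ≤-trans
        (count-cover (Displaced? c₀) (Clash? u) (Clash? v) cover V)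
        (+-mono-≤ (clash≤1 Du 2≤c₀) (clash≤1 Dv 2≤c₀))
        where
        cover : ∀ {z} → Displaced c₀ z → Clash u z ⊎ Clash v z
        cover {z} Dz with proj₁ u Fin.≟ proj₁ z
        ... | yes u∼z = inj₂ (clash-across Dv Dz λ v∼z → u≁v (trans u∼z (sym v∼z)))
        ... | no u≁z = inj₁ (clash-across Du Dz u≁z)

      -- If the ranks of u and v differ, two samples share a colour, so c₀ occurs twice
      -- in V_i; then at most two vertices are displaced, the ranks are 0 and 1, and the
      -- palette gives three samples of one colour.  But u, which sees v, allows at most
      -- two occurrences of c₀ in V_i.
      separates : ∀ {u v} → Displaced c₀ u → Displaced c₀ v → τ u ≡ τ v → proj₁ u ≡ proj₁ v
      separates {u} {v} Du Dv τu≡τv with proj₁ u Fin.≟ proj₁ v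
      ... | yes u∼v = u∼v
      ... | no u≁v with rank u ≟ rank v
      ...   | yes r≡ = ⊥-elim (u≁v (cong proj₁ (rank-injective Du Dv r≡)))
      ...   | no r≢ = ⊥-elim (<-irrefl refl (begin
        3                           ≤⟨ first∼second⇒frequent first∼second ⟩
        inPartCount (colour first)  ≤⟨ c₀-maximal first ⟩
        inPartCount c₀              ≤⟨ c₀≤2 Du Dv u≁v ⟩
        2                           ∎))
        where
        open ≤-Reasoning
        c₀-frequent : 2 ≤ inPartCount c₀
        c₀-frequent = ≤-trans
          (samples≤inPartCount (((r≢ ∘ pick-injective (rank≤2 Du) (rank≤2 Dv)) ∷ []) ∷ [] ∷ [])
                               (refl ∷ sym τu≡τv ∷ []))
          (c₀-maximal (pick (rank u)))
        rank≤1 : ∀ {z} → Displaced c₀ z → rank z ≤ 1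
        rank≤1 Dz = ≤-pred (≤-trans (rank< Dz) (displaced≤2 Du Dv u≁v c₀-frequent))
        first∼second : colour first ≡ colour second
        first∼second = coincide (rank≤1 Du) (rank≤1 Dv) r≢ τu≡τv

      paletteRelocation : Relocation c₀
      paletteRelocation = record
        { τ = τ
        ; avoids = λ {v} _ → pick-spare (rank v)
        ; fits = fits
        ; usedInPart = λ {v} _ → inject≤ (pick (rank v)) 6≤nᵢ , refl
        ; separates = separates
        }

    relocation : Relocation c₀
    relocation with any? (Displaced? c₀) V
    ... | yes someDisplaced = paletteRelocation (palette (proj₂ (Any.satisfied someDisplaced)))
    ... | no noneDisplaced =
      vacuousRelocation c₀ λ v Dv → noneDisplaced (lose (∈-vertices v) Dv)

lemma5p1 : (s : ℕ) → 2 ≤ s → (n : Fin s → ℕ) → (∃ λ i → 6 ≤ n i) →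
    (k : ℕ) → IsChi3 s n k →
    ∃ λ (f : Vertex s n → Fin k) → Is3Relaxed f ×
    (∃ λ j → 6 ≤ n j × ∃ λ (c : Fin k) → ∀ (a : Fin (n j)) → f (j , a) ≡ c)
lemma5p1 s _ n (i , 6≤nᵢ) k ((f , f-relaxed) , _) =
  recoloured c₀ relocation , recoloured-relaxed c₀ relocation ,
  i , 6≤nᵢ , c₀ , recoloured-inside c₀ relocation
  where
  open Recolouring f f-relaxed i
  open Samples 6≤nᵢ
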